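{- Let $k$ and $j$ be positive integers. In any graph $G$, every vertex belonging to a $k$-resolving set of $G$ of size $j$ has degree at most $3^{j-1}$. Moreover, for $k\ge 2$ this bound is sharp: for every positive integer $j$ there exist a graph $G$ and a $k$-resolving set of $G$ of size $j$ containing a vertex of degree $3^{j-1}$.
   Context: Graphs are finite, simple, undirected, possibly disconnected; $\textnormal{dist}(u,v)=\infty$ between different components. For a positive integer $k$, a set $S=\{v_1,\dots,v_j\}$ of vertices is a $k$-resolving set of $G$ if the vectors $(\min(k+1,\textnormal{dist}(u,v_1)),\dots,\min(k+1,\textnormal{dist}(u,v_j)))$ are pairwise distinct over $u\in V(G)$. -}

module Defs where

open import Data.Nat using (ℕ; zero; suc; _≤_; _<_)
open import Data.Fin using (Fin)
open import Data.Bool using (Bool; true; false)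
open import Data.List using (List; length; filterᵇ; allFin)
open import Data.Product using (Σ; _×_; ∃)
open import Data.Sum using (_⊎_)
open import Relation.Nullary using (¬_)
open import Relation.Binary.PropositionalEquality using (_≡_)

record Graph (n : ℕ) : Set where
  field
    adj   : Fin n → Fin n → Bool
    sym   : ∀ u v → adj u v ≡ adj v u
    irrefl : ∀ v → adj v v ≡ false
open Graph public

degree : ∀ {n} → Graph n → Fin n → ℕ
degree {n} G v = length (filterᵇ (adj G v) (allFin n))

data Walk {n : ℕ} (G : Graph n) : Fin n → Fin n → ℕ → Set where
  nil  : ∀ {u} → Walk G u u zero
  cons : ∀ {u x v m} → adj G u x ≡ true → Walk G x v m → Walk G u v (suc m)

Dist : ∀ {n} → Graph n → Fin n → Fin n → ℕ → Set
Dist G u v d = Walk G u v d × (∀ m → m < d → ¬ Walk G u v m)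

-- TDist k G u v t : t = min(k+1, dist(u,v))  (dist = ∞ when no walk exists).
TDist : ∀ {n} → ℕ → Graph n → Fin n → Fin n → ℕ → Set
TDist k G u v t =
  (t ≤ k × Dist G u v t) ⊎ (t ≡ suc k × (∀ m → m ≤ k → ¬ Walk G u v m))

Resolving : ∀ {n j} → ℕ → Graph n → (Fin j → Fin n) → Set
Resolving {n} k G S =
  ∀ (u w : Fin n) →
  (∀ i → Σ ℕ (λ t → TDist k G u (S i) t × TDist k G w (S i) t)) →
  u ≡ w

module Submission where

-- Upper bound: a neighbour y of the landmark v = S i has truncated distance 1 to v, and
-- truncated distance changes by at most one along an edge, so for every other landmark the
-- truncated distance from y is that from v minus one, the same, or plus one. These j - 1
-- offsets form a word in {0,1,2}^(j-1) which, as S is resolving, determines y; hence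
-- deg v ≤ 3^(j-1).
--
-- Sharpness (j = m + 1): take the 3^m words x ∈ {0,1,2}^m, all joined to a hub, and for each
-- coordinate i an anchor adjacent to the words with x_i = 0 and a helper adjacent to the
-- anchor and to the words with x_i = 1. The landmarks are the hub and the m anchors. Every
-- distance to a landmark is at most 3, hence untruncated when k ≥ 2; the distance from x to
-- the i-th anchor is x_i + 1, so the words are resolved, the other vertices are resolved by
-- their distances 0, 1, 2 to the landmarks, and the hub has degree 3^m. Each claimed distance
-- is certified by an explicit walk together with the fact that the claimed distances change
-- by at most one along every edge.

open import Defs hiding (sym)
open import Data.Nat using (ℕ; zero; suc; _≤_; _+_; _^_; _∸_; z≤n; s≤s)
open import Data.Nat.Properties
  using (≤-refl; ≤-trans; ≤-antisym; ≤-pred; <-cmp; <⇒≱; ≮⇒≥; ≰⇒>; n≤1+n;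
         m≤n⇒m≤1+n; m≤n⇒m<n∨m≡n; suc-injective; +-identityʳ; module ≤-Reasoning)
open import Data.Fin as Fin
  using (Fin; zero; suc; toℕ; _↑ˡ_; _↑ʳ_; punchIn; punchOut; combine; finToFun; funToFin)
open import Data.Fin.Patterns using (0F; 1F; 2F)
open import Data.Fin.Properties
  using (any?; injective⇒≤; toℕ-injective; toℕ<n; punchIn-punchOut;
         finToFun-funToFin; funToFin-finToFin; +↔⊎; 1↔⊤)
open import Data.Bool using (Bool; true; false; T; if_then_else_)
open import Data.Bool.Properties using (T?; T-≡; ∨-comm)
import Data.Bool.Properties as Bool
open import Data.Unit using (⊤; tt)
open import Data.Product using (Σ; ∃; _×_; _,_; proj₁; proj₂; swap)
open import Data.Sum using (_⊎_; inj₁; inj₂; [_,_]′)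
open import Data.List using (List; length; lookup; tabulate; filterᵇ; allFin)
open import Data.List.Properties using (filter-accept; filter-none)
import Data.List.Relation.Unary.All as All
open import Data.List.Relation.Unary.All.Properties using (tabulate⁺)
open import Data.List.Relation.Unary.AllPairs using (_∷_)
open import Data.List.Relation.Unary.Unique.Propositional using (Unique)
open import Data.List.Relation.Unary.Unique.Propositional.Properties using (filter⁺; allFin⁺)
open import Data.List.Membership.Propositional using (_∈_)
open import Data.List.Membership.Propositional.Properties using (∈-lookup; ∈-filter⁻)
open import Data.Sum.Function.Propositional using (_⊎-↔_)
open import Function using (_∘_; id; _↔_; Inverse; Injection; Equivalence)
open import Function.Definitions using (Injective)
open import Function.Properties.Inverse using (↔-trans; ↔-refl; ↔-sym; ↔⇒↣)
open import Relation.Binary.Definitions using (Decidable; tri<; tri≈; tri>)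
open import Relation.Binary.PropositionalEquality
  using (_≡_; _≢_; refl; sym; trans; cong; cong₂; subst; _≗_; module ≡-Reasoning)
open import Relation.Nullary using (¬_; Dec; yes; no; does; contradiction)
open import Relation.Nullary.Decidable using (map′; _×-dec_; _⊎-dec_; dec-true; dec-false)

Near : ℕ → ℕ → Set
Near a b = a ≤ suc b × b ≤ suc a

near-refl : ∀ {a} → Near a a
near-refl = n≤1+n _ , n≤1+n _

near-suc : ∀ {a} → Near a (suc a)
near-suc = m≤n⇒m≤1+n (n≤1+n _) , ≤-refl

near-sym : ∀ {a b} → Near a b → Near b a
near-sym = swap

compare₃ : ℕ → ℕ → Fin 3
compare₃ a b with <-cmp a b
... | tri< _ _ _ = 0F
... | tri≈ _ _ _ = 1F
... | tri> _ _ _ = 2F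

compare₃-injective : ∀ {a a' b} → Near a b → Near a' b → compare₃ a b ≡ compare₃ a' b → a ≡ a'
compare₃-injective {a} {a'} {b} (a≤1+b , b≤1+a) (a'≤1+b , b≤1+a') eq
  with <-cmp a b | <-cmp a' b
... | tri< a<b _ _ | tri< a'<b _ _ =
  suc-injective (trans (≤-antisym a<b b≤1+a) (sym (≤-antisym a'<b b≤1+a')))
... | tri≈ _ refl _ | tri≈ _ refl _ = refl
... | tri> _ _ a>b | tri> _ _ a'>b = trans (≤-antisym a≤1+b a>b) (sym (≤-antisym a'≤1+b a'>b))
compare₃-injective _ _ () | tri< _ _ _ | tri≈ _ _ _
compare₃-injective _ _ () | tri< _ _ _ | tri> _ _ _
compare₃-injective _ _ () | tri≈ _ _ _ | tri< _ _ _
compare₃-injective _ _ () | tri≈ _ _ _ | tri> _ _ _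
compare₃-injective _ _ () | tri> _ _ _ | tri< _ _ _
compare₃-injective _ _ () | tri> _ _ _ | tri≈ _ _ _

funToFin-cong : ∀ {m n} {f g : Fin m → Fin n} → f ≗ g → funToFin f ≡ funToFin g
funToFin-cong {zero} _ = refl
funToFin-cong {suc m} f≗g = cong₂ combine (f≗g zero) (funToFin-cong (f≗g ∘ suc))

finToFun-injective : ∀ {m n} {x y : Fin (n ^ m)} → finToFun {n} {m} x ≗ finToFun y → x ≡ y
finToFun-injective {m} {n} {x} {y} eq = begin
  x                              ≡⟨ funToFin-finToFin {m} {n} x ⟨
  funToFin (finToFun {n} {m} x)  ≡⟨ funToFin-cong eq ⟩
  funToFin (finToFun {n} {m} y)  ≡⟨ funToFin-finToFin {m} {n} y ⟩
  y                              ∎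
  where open ≡-Reasoning

lookup-injective : ∀ {A : Set} {xs : List A} → Unique xs → Injective _≡_ _≡_ (lookup xs)
lookup-injective (_ ∷ _) {zero} {zero} _ = refl
lookup-injective (x∉xs ∷ _) {zero} {suc j} eq = contradiction eq (All.lookup x∉xs (∈-lookup j))
lookup-injective (x∉xs ∷ _) {suc i} {zero} eq = contradiction (sym eq) (All.lookup x∉xs (∈-lookup i))
lookup-injective (_ ∷ xs-unique) {suc i} {suc j} eq = cong suc (lookup-injective xs-unique eq)

Unique⇒length≤ : ∀ {A : Set} {xs : List A} {N} → Unique xs → (f : A → Fin N) →
  (∀ {x y} → x ∈ xs → y ∈ xs → f x ≡ f y → x ≡ y) → length xs ≤ N
Unique⇒length≤ {xs = xs} xs-unique f f-injective = injective⇒≤ {f = f ∘ lookup xs}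
  λ eq → lookup-injective xs-unique (f-injective (∈-lookup _) (∈-lookup _) eq)

length-filterᵇ-tabulate : ∀ {A : Set} a {b} (g : Fin (a + b) → A) (p : A → Bool) →
  (∀ x → p (g (x ↑ˡ b)) ≡ true) → (∀ y → p (g (a ↑ʳ y)) ≡ false) →
  length (filterᵇ p (tabulate g)) ≡ a
length-filterᵇ-tabulate zero g p _ rejected =
  cong length (filter-none (T? ∘ p) (tabulate⁺ λ y → subst T (rejected y)))
length-filterᵇ-tabulate (suc a) g p accepted rejected =
  trans (cong length (filter-accept (T? ∘ p) (Equivalence.from T-≡ (accepted zero))))
        (cong suc (length-filterᵇ-tabulate a (g ∘ suc) p (accepted ∘ suc) rejected))

module _ {n : ℕ} (G : Graph n) where

  Lipschitz : (Fin n → ℕ) → Set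
  Lipschitz φ = ∀ {a b} → adj G a b ≡ true → φ a ≤ suc (φ b)

  walk? : ∀ L u v → Dec (Walk G u v L)
  walk? zero u v = map′ (λ { refl → nil }) (λ { nil → refl }) (u Fin.≟ v)
  walk? (suc L) u v = map′ (λ (_ , e , w) → cons e w) (λ { (cons e w) → _ , e , w })
    (any? λ x → (adj G u x Bool.≟ true) ×-dec walk? L x v)

  Walk-0 : ∀ {u v} → Walk G u v 0 → u ≡ v
  Walk-0 nil = refl

  no-loop : ∀ u → adj G u u ≢ true
  no-loop u e = contradiction (trans (sym e) (irrefl G u)) λ ()

  Dist-adjacent : ∀ {u v} → adj G u v ≡ true → Dist G u v 1
  Dist-adjacent {u} e = cons e nil , λ
    { zero _ w → no-loop u (subst (λ v → adj G u v ≡ true) (sym (Walk-0 w)) e)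
    ; (suc _) (s≤s ()) }

  Lipschitz-≤-walk : ∀ {φ} → Lipschitz φ → ∀ {u v L} → Walk G u v L → φ u ≤ L + φ v
  Lipschitz-≤-walk lipschitz nil = ≤-refl
  Lipschitz-≤-walk lipschitz (cons e w) = ≤-trans (lipschitz e) (s≤s (Lipschitz-≤-walk lipschitz w))

  Dist-potential : (φ : Fin n → ℕ) → Lipschitz φ →
    ∀ {u v d} → φ v ≡ 0 → φ u ≡ d → Walk G u v d → Dist G u v d
  Dist-potential φ lipschitz {u} {v} φv≡0 refl w = w , λ m m<d w' → <⇒≱ m<d (begin
    φ u      ≤⟨ Lipschitz-≤-walk lipschitz w' ⟩
    m + φ v  ≡⟨ cong (m +_) φv≡0 ⟩
    m + 0    ≡⟨ +-identityʳ m ⟩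
    m        ∎)
    where open ≤-Reasoning

  Dist⇒TDist : ∀ {k u v d} → Dist G u v d → d ≤ suc k → TDist k G u v d
  Dist⇒TDist (w , shorter) d≤1+k with m≤n⇒m<n∨m≡n d≤1+k
  ... | inj₁ d<1+k = inj₁ (≤-pred d<1+k , w , shorter)
  ... | inj₂ refl = inj₂ (refl , λ m m≤k → shorter m (s≤s m≤k))

  tdist : ∀ k u v → ∃ (TDist k G u v)
  tdist zero u v with walk? 0 u v
  ... | yes w = 0 , Dist⇒TDist (w , λ _ ()) z≤n
  ... | no ¬w = 1 , inj₂ (refl , λ { zero _ → ¬w ; (suc _) () })
  tdist (suc k) u v with tdist k u v
  ... | t , inj₁ (t≤k , d) = t , inj₁ (m≤n⇒m≤1+n t≤k , d)
  ... | _ , inj₂ (refl , none) with walk? (suc k) u v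
  ...   | yes w = suc k , Dist⇒TDist (w , λ m m<1+k → none m (≤-pred m<1+k)) (n≤1+n _)
  ...   | no ¬w = suc (suc k) , inj₂ (refl , λ m m≤1+k →
                    [ none m ∘ ≤-pred , (λ { refl → ¬w }) ]′ (m≤n⇒m<n∨m≡n m≤1+k))

  TDist-≤ : ∀ {k u v t} → TDist k G u v t → t ≤ suc k
  TDist-≤ (inj₁ (t≤k , _)) = m≤n⇒m≤1+n t≤k
  TDist-≤ (inj₂ (refl , _)) = ≤-refl

  TDist-≤-walk : ∀ {k u v t L} → TDist k G u v t → Walk G u v L → t ≤ L
  TDist-≤-walk (inj₁ (_ , _ , shorter)) w = ≮⇒≥ λ L<t → shorter _ L<t w
  TDist-≤-walk (inj₂ (refl , none)) w = ≰⇒> λ L≤k → none _ L≤k w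

  TDist-functional : ∀ {k u v t t'} → TDist k G u v t → TDist k G u v t' → t ≡ t'
  TDist-functional T@(inj₁ (_ , w , _)) T'@(inj₁ (_ , w' , _)) =
    ≤-antisym (TDist-≤-walk T w') (TDist-≤-walk T' w)
  TDist-functional (inj₁ (t≤k , w , _)) (inj₂ (_ , none)) = contradiction w (none _ t≤k)
  TDist-functional (inj₂ (_ , none)) (inj₁ (t≤k , w , _)) = contradiction w (none _ t≤k)
  TDist-functional (inj₂ (refl , _)) (inj₂ (refl , _)) = refl

  TDist-adjacent : ∀ {k u x v a b} → adj G u x ≡ true →
    TDist k G u v a → TDist k G x v b → a ≤ suc b
  TDist-adjacent e T (inj₁ (_ , w , _)) = TDist-≤-walk T (cons e w)
  TDist-adjacent e T (inj₂ (refl , _)) = m≤n⇒m≤1+n (TDist-≤ T)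

module _ {k m n} {G : Graph n} {S : Fin (suc m) → Fin n}
         (resolving : Resolving k G S) (i : Fin (suc m)) where

  private
    v : Fin n
    v = S i

    τ : Fin n → Fin (suc m) → ℕ
    τ y l = proj₁ (tdist G k y (S l))

    τ-TDist : ∀ y l → TDist k G y (S l) (τ y l)
    τ-TDist y l = proj₂ (tdist G k y (S l))

    offset : Fin n → Fin (suc m) → Fin 3
    offset y l = compare₃ (τ y l) (τ v l)

  signature : Fin n → Fin (3 ^ m)
  signature y = funToFin (offset y ∘ punchIn i)

  neighbour-near : ∀ {y} → adj G v y ≡ true → ∀ l → Near (τ y l) (τ v l)
  neighbour-near {y} e l =
    TDist-adjacent G (trans (Graph.sym G y v) e) (τ-TDist y l) (τ-TDist v l) ,
    TDist-adjacent G e (τ-TDist v l) (τ-TDist y l)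

  neighbour-TDist : ∀ {y} → adj G v y ≡ true → TDist k G y v 1
  neighbour-TDist {y} e = Dist⇒TDist G (Dist-adjacent G (trans (Graph.sym G y v) e)) (s≤s z≤n)

  signature-injective : ∀ {y y'} → adj G v y ≡ true → adj G v y' ≡ true →
    signature y ≡ signature y' → y ≡ y'
  signature-injective {y} {y'} e e' eq = resolving y y' agree
    where
    same-offset : ∀ l → i ≢ l → offset y l ≡ offset y' l
    same-offset l i≢l = begin
      offset y l                      ≡⟨ cong (offset y) (punchIn-punchOut i≢l) ⟨
      offset y (punchIn i l')         ≡⟨ finToFun-funToFin (offset y ∘ punchIn i) l' ⟨
      finToFun (signature y) l'       ≡⟨ cong (λ z → finToFun z l') eq ⟩
      finToFun (signature y') l'      ≡⟨ finToFun-funToFin (offset y' ∘ punchIn i) l' ⟩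
      offset y' (punchIn i l')        ≡⟨ cong (offset y') (punchIn-punchOut i≢l) ⟩
      offset y' l                     ∎
      where
      open ≡-Reasoning
      l' : Fin m
      l' = punchOut i≢l

    agree : ∀ l → ∃ λ t → TDist k G y (S l) t × TDist k G y' (S l) t
    agree l with i Fin.≟ l
    ... | yes refl = 1 , neighbour-TDist e , neighbour-TDist e'
    ... | no i≢l = τ y l , τ-TDist y l , subst (TDist k G y' (S l)) (sym same-τ) (τ-TDist y' l)
      where
      same-τ : τ y l ≡ τ y' l
      same-τ = compare₃-injective (neighbour-near e l) (neighbour-near e' l) (same-offset l i≢l)

  degree-≤ : degree G v ≤ 3 ^ m
  degree-≤ = Unique⇒length≤ (filter⁺ (T? ∘ adj G v) (allFin⁺ n)) signature
    λ y∈ y'∈ → signature-injective (neighbour y∈) (neighbour y'∈)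
    where
    neighbour : ∀ {y} → y ∈ filterᵇ (adj G v) (allFin n) → adj G v y ≡ true
    neighbour y∈ = Equivalence.to T-≡ (proj₂ (∈-filter⁻ (T? ∘ adj G v) {xs = allFin n} y∈))

module EdgeGraph {V : Set} {n : ℕ} (ι : Fin n ↔ V)
  {E : V → V → Set} (E? : Decidable E) (E-irrefl : ∀ {u} → ¬ E u u) where

  open Inverse ι using (to; from; strictlyInverseˡ)

  to-injective : Injective _≡_ _≡_ to
  to-injective = Injection.injective (↔⇒↣ ι)

  from-injective : Injective _≡_ _≡_ from
  from-injective = Injection.injective (↔⇒↣ (↔-sym ι))

  adjacent : V → V → Bool
  adjacent u w = does (E? u w ⊎-dec E? w u)

  graph : Graph n
  graph = record
    { adj = λ a b → adjacent (to a) (to b)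
    ; sym = λ a b → ∨-comm (does (E? (to a) (to b))) (does (E? (to b) (to a)))
    ; irrefl = λ a → dec-false (E? (to a) (to a) ⊎-dec E? (to a) (to a)) [ E-irrefl , E-irrefl ]′
    }

  adj-from : ∀ u w → adj graph (from u) (from w) ≡ adjacent u w
  adj-from u w = cong₂ adjacent (strictlyInverseˡ u) (strictlyInverseˡ w)

  link : ∀ {u w} → E u w ⊎ E w u → adj graph (from u) (from w) ≡ true
  link {u} {w} e = trans (adj-from u w) (dec-true (E? u w ⊎-dec E? w u) e)

  no-link : ∀ {u w} → ¬ (E u w ⊎ E w u) → adj graph (from u) (from w) ≡ false
  no-link {u} {w} ¬e = trans (adj-from u w) (dec-false (E? u w ⊎-dec E? w u) ¬e)

  unlink : ∀ {a b} → adj graph a b ≡ true → E (to a) (to b) ⊎ E (to b) (to a)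
  unlink {a} {b} e with E? (to a) (to b) | E? (to b) (to a)
  ... | yes ab | _ = inj₁ ab
  ... | no _ | yes ba = inj₂ ba
  unlink () | no _ | no _

  step : ∀ {u w t L} → E u w ⊎ E w u → Walk graph (from w) t L → Walk graph (from u) t (suc L)
  step = cons ∘ link

  shortest-walk : (φ : V → ℕ) → (∀ {u w} → E u w → Near (φ u) (φ w)) →
    ∀ {u v} → φ v ≡ 0 → Walk graph (from u) (from v) (φ u) → Dist graph (from u) (from v) (φ u)
  shortest-walk φ near {u} {v} φv≡0 =
    Dist-potential graph (φ ∘ to) lipschitz
      (trans (cong φ (strictlyInverseˡ v)) φv≡0) (cong φ (strictlyInverseˡ u))
    where
    lipschitz : Lipschitz graph (φ ∘ to)
    lipschitz e = [ proj₁ ∘ near , proj₂ ∘ near ]′ (unlink e)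

module Construction (m : ℕ) where

  V : Set
  V = Fin (3 ^ m) ⊎ (⊤ ⊎ (Fin m ⊎ Fin m))

  pattern word x = inj₁ x
  pattern hub = inj₂ (inj₁ tt)
  pattern anchor i = inj₂ (inj₂ (inj₁ i))
  pattern helper i = inj₂ (inj₂ (inj₂ i))

  n : ℕ
  n = 3 ^ m + (1 + (m + m))

  ι-spokes : Fin (1 + (m + m)) ↔ (⊤ ⊎ (Fin m ⊎ Fin m))
  ι-spokes = ↔-trans +↔⊎ (1↔⊤ ⊎-↔ +↔⊎)

  -- Words come first, so the neighbours of the hub are exactly the first 3 ^ m vertices.
  ι : Fin n ↔ V
  ι = ↔-trans +↔⊎ (↔-refl ⊎-↔ ι-spokes)

  open Inverse ι using (to; from; strictlyInverseˡ; strictlyInverseʳ)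

  digit : Fin (3 ^ m) → Fin m → Fin 3
  digit = finToFun

  data Edge : V → V → Set where
    hub-word      : ∀ {x} → Edge hub (word x)
    anchor-word   : ∀ {x i} → digit x i ≡ 0F → Edge (anchor i) (word x)
    helper-word   : ∀ {x i} → digit x i ≡ 1F → Edge (helper i) (word x)
    anchor-helper : ∀ {i} → Edge (anchor i) (helper i)

  Edge? : Decidable Edge
  Edge? hub (word _) = yes hub-word
  Edge? hub (inj₂ _) = no λ ()
  Edge? (word _) _ = no λ ()
  Edge? (anchor i) (word x) = map′ anchor-word (λ { (anchor-word d) → d }) (digit x i Fin.≟ 0F)
  Edge? (anchor i) (helper i') =
    map′ (λ { refl → anchor-helper }) (λ { anchor-helper → refl }) (i Fin.≟ i')
  Edge? (anchor _) hub = no λ ()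
  Edge? (anchor _) (anchor _) = no λ ()
  Edge? (helper i) (word x) = map′ helper-word (λ { (helper-word d) → d }) (digit x i Fin.≟ 1F)
  Edge? (helper _) (inj₂ _) = no λ ()

  Edge-irrefl : ∀ {u} → ¬ Edge u u
  Edge-irrefl ()

  open EdgeGraph ι Edge? Edge-irrefl public

  landmark : Fin (suc m) → V
  landmark zero = hub
  landmark (suc i) = anchor i

  S : Fin (suc m) → Fin n
  S = from ∘ landmark

  uniform : Fin 3 → Fin (3 ^ m)
  uniform d = funToFin λ (_ : Fin m) → d

  uniform-digit : ∀ d i → digit (uniform d) i ≡ d
  uniform-digit d = finToFun-funToFin λ (_ : Fin m) → d

  separator : Fin m → Fin (3 ^ m)
  separator i = funToFin λ t → if does (t Fin.≟ i) then 0F else 1F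

  separator-digit-at : ∀ i → digit (separator i) i ≡ 0F
  separator-digit-at i =
    trans (finToFun-funToFin _ i) (cong (λ b → if b then 0F else 1F) (dec-true (i Fin.≟ i) refl))

  separator-digit-off : ∀ {i t} → t ≢ i → digit (separator i) t ≡ 1F
  separator-digit-off {i} {t} t≢i =
    trans (finToFun-funToFin _ t) (cong (λ b → if b then 0F else 1F) (dec-false (t Fin.≟ i) t≢i))

  distance : Fin (suc m) → V → ℕ
  distance zero hub = 0
  distance zero (word _) = 1
  distance zero (anchor _) = 2
  distance zero (helper _) = 2
  distance (suc i) hub = 2
  distance (suc i) (word x) = suc (toℕ (digit x i))
  distance (suc i) (anchor i') with i Fin.≟ i'
  ... | yes _ = 0
  ... | no _ = 2
  distance (suc i) (helper i') with i Fin.≟ i'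
  ... | yes _ = 1
  ... | no _ = 2

  distance≤3 : ∀ l u → distance l u ≤ 3
  distance≤3 zero hub = z≤n
  distance≤3 zero (word _) = s≤s z≤n
  distance≤3 zero (anchor _) = s≤s (s≤s z≤n)
  distance≤3 zero (helper _) = s≤s (s≤s z≤n)
  distance≤3 (suc i) hub = s≤s (s≤s z≤n)
  distance≤3 (suc i) (word x) = toℕ<n (digit x i)
  distance≤3 (suc i) (anchor i') with i Fin.≟ i'
  ... | yes _ = z≤n
  ... | no _ = s≤s (s≤s z≤n)
  distance≤3 (suc i) (helper i') with i Fin.≟ i'
  ... | yes _ = s≤s z≤n
  ... | no _ = s≤s (s≤s z≤n)

  distance-anchor-self : ∀ i → distance (suc i) (anchor i) ≡ 0
  distance-anchor-self i with i Fin.≟ i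
  ... | yes _ = refl
  ... | no i≢i = contradiction refl i≢i

  distance-helper-self : ∀ i → distance (suc i) (helper i) ≡ 1
  distance-helper-self i with i Fin.≟ i
  ... | yes _ = refl
  ... | no i≢i = contradiction refl i≢i

  distance-helper≡1 : ∀ {i i'} → distance (suc i) (helper i') ≡ 1 → i ≡ i'
  distance-helper≡1 {i} {i'} _ with i Fin.≟ i'
  ... | yes i≡i' = i≡i'
  distance-helper≡1 () | no _

  distance-landmark : ∀ l → distance l (landmark l) ≡ 0
  distance-landmark zero = refl
  distance-landmark (suc i) = distance-anchor-self i

  near-digit : ∀ (d : Fin 3) → Near 2 (suc (toℕ d))
  near-digit 0F = near-sym near-suc
  near-digit 1F = near-refl
  near-digit 2F = near-suc

  distance-near : ∀ l {u w} → Edge u w → Near (distance l u) (distance l w)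
  distance-near zero hub-word = near-suc
  distance-near zero (anchor-word _) = near-sym near-suc
  distance-near zero (helper-word _) = near-sym near-suc
  distance-near zero anchor-helper = near-refl
  distance-near (suc i) (hub-word {x}) = near-digit (digit x i)
  distance-near (suc i) (anchor-word {x} {i'} d) with i Fin.≟ i'
  ... | yes refl rewrite d = near-suc
  ... | no _ = near-digit (digit x i)
  distance-near (suc i) (helper-word {x} {i'} d) with i Fin.≟ i'
  ... | yes refl rewrite d = near-suc
  ... | no _ = near-digit (digit x i)
  distance-near (suc i) (anchor-helper {i'}) with i Fin.≟ i'
  ... | yes _ = near-suc
  ... | no _ = near-refl

  route : ∀ l u → Walk graph (from u) (S l) (distance l u)
  route zero hub = nil
  route zero (word x) = step (inj₂ hub-word) nil
  route zero (anchor i) = step (inj₁ (anchor-word (uniform-digit 0F i))) (route zero (word _))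
  route zero (helper i) = step (inj₁ (helper-word (uniform-digit 1F i))) (route zero (word _))
  route (suc i) hub = step (inj₁ hub-word) (step (inj₂ (anchor-word (uniform-digit 0F i))) nil)
  route (suc i) (word x) with digit x i in d
  ... | 0F = step (inj₂ (anchor-word d)) nil
  ... | 1F = step (inj₂ (helper-word d)) (step (inj₂ anchor-helper) nil)
  ... | 2F = step (inj₂ hub-word) (route (suc i) hub)
  route (suc i) (anchor i') with i Fin.≟ i'
  ... | yes refl = nil
  ... | no _ = step (inj₁ (anchor-word (uniform-digit 0F i')))
                    (step (inj₂ (anchor-word (uniform-digit 0F i))) nil)
  route (suc i) (helper i') with i Fin.≟ i'
  ... | yes refl = step (inj₂ anchor-helper) nil
  ... | no i≢i' = step (inj₁ (helper-word (separator-digit-off (i≢i' ∘ sym))))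
                       (step (inj₂ (anchor-word (separator-digit-at i))) nil)

  distance≡0⇒landmark : ∀ l {u} → distance l u ≡ 0 → u ≡ landmark l
  distance≡0⇒landmark l {u} zero-length =
    from-injective (Walk-0 graph (subst (Walk graph (from u) (S l)) zero-length (route l u)))

  distance-injective : ∀ u w → (∀ l → distance l u ≡ distance l w) → u ≡ w
  distance-injective hub w same = sym (distance≡0⇒landmark zero (sym (same zero)))
  distance-injective u hub same = distance≡0⇒landmark zero (same zero)
  distance-injective (anchor i) w same =
    sym (distance≡0⇒landmark (suc i) (trans (sym (same (suc i))) (distance-anchor-self i)))
  distance-injective u (anchor i) same =
    distance≡0⇒landmark (suc i) (trans (same (suc i)) (distance-anchor-self i))
  distance-injective (word x) (word y) same =
    cong word (finToFun-injective λ i → toℕ-injective (suc-injective (same (suc i))))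
  distance-injective (helper i) (helper _) same =
    cong helper (distance-helper≡1 (trans (sym (same (suc i))) (distance-helper-self i)))
  distance-injective (word _) (helper _) same = contradiction (same zero) λ ()
  distance-injective (helper _) (word _) same = contradiction (same zero) λ ()

  landmark-Dist : ∀ l a → Dist graph a (S l) (distance l (to a))
  landmark-Dist l a = subst (λ b → Dist graph b (S l) (distance l (to a))) (strictlyInverseʳ a)
    (shortest-walk (distance l) (distance-near l) (distance-landmark l) (route l (to a)))

  resolving : ∀ {k} → 2 ≤ k → Resolving k graph S
  resolving {k} k≥2 a b agree = to-injective (distance-injective (to a) (to b) same-distance)
    where
    landmark-TDist : ∀ l c → TDist k graph c (S l) (distance l (to c))
    landmark-TDist l c =
      Dist⇒TDist graph (landmark-Dist l c) (≤-trans (distance≤3 l (to c)) (s≤s k≥2))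

    same-distance : ∀ l → distance l (to a) ≡ distance l (to b)
    same-distance l = let (t , a-t , b-t) = agree l in
      trans (TDist-functional graph (landmark-TDist l a) a-t)
            (TDist-functional graph b-t (landmark-TDist l b))

  landmark-injective : Injective _≡_ _≡_ landmark
  landmark-injective {zero} {zero} _ = refl
  landmark-injective {suc _} {suc _} refl = refl

  S-injective : Injective _≡_ _≡_ S
  S-injective = landmark-injective ∘ from-injective

  hub-degree : degree graph (S zero) ≡ 3 ^ m
  hub-degree =
    length-filterᵇ-tabulate (3 ^ m) id (adj graph (from hub)) (λ _ → link (inj₁ hub-word)) non-words
    where
    non-words : ∀ y → adj graph (from hub) (3 ^ m ↑ʳ y) ≡ false
    non-words y =
      subst (λ z → adj graph (from hub) (3 ^ m ↑ʳ z) ≡ false) (Inverse.strictlyInverseʳ ι-spokes y)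
      (no-link {hub} {inj₂ (Inverse.to ι-spokes y)} λ { (inj₁ ()) ; (inj₂ ()) })

theorem22 : (k j : ℕ) → 1 ≤ k → 1 ≤ j →
    ((n : ℕ) (G : Graph n) (S : Fin j → Fin n) →
       Injective _≡_ _≡_ S → Resolving k G S →
       (i : Fin j) → degree G (S i) ≤ 3 ^ (j ∸ 1))
    × (2 ≤ k →
       Σ ℕ (λ n → Σ (Graph n) (λ G → Σ (Fin j → Fin n) (λ S →
         Injective _≡_ _≡_ S × Resolving k G S ×
         Σ (Fin j) (λ i → degree G (S i) ≡ 3 ^ (j ∸ 1))))))
-- The upper bound holds for every k and needs no injectivity of S.
theorem22 k (suc m) _ _ =
  (λ _ _ _ _ resolving i → degree-≤ resolving i) ,
  λ k≥2 → n , graph , S , S-injective , resolving k≥2 , zero , hub-degree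
  where open Construction m
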